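{- Let $s,k$ be coprime positive integers with $s\ge2$, and let $\overline{s}=s\bmod k$. For all $i\in\{0,1,\dots,k-1\}$, \[ |\mathcal{L}_i|=\begin{cases} 0 &\text{if } s \mid i \text{ and } i > 0,\\ \left\lfloor\frac{s-1}{k}\right\rfloor &\text{if } i = \overline{s},\\ 1 &\text{if } i=\lceil k/s\rceil s \bmod k \text{ and } k>s,\\ \left\lfloor\frac{s-1}{k}\right\rfloor + 1 &\text{if } i=0 \text{ and } k > 1, \\ \left\lfloor\frac{s-1}{k}\right\rfloor+1 &\text{if } \overline{s} < i \text{ and } s \nmid i,\\ \left\lfloor\frac{s-1}{k}\right\rfloor+2 &\text{if } 0 < i < \overline{s} \text{ and } i \neq \lceil k/s\rceil s \bmod k. \end{cases} \]
   Context: Let $\mathcal{P}=\mathbb{Z}_{>0}\setminus\{as+b(s+k) : a,b\in\mathbb{Z}_{\ge0}\}$ and $\mathcal{E}=\mathcal{P}\cap\{1,\dots,s+k-1\}$. For $i\in\mathbb{Z}$, the ledge $\mathcal{L}_i$ is $\{x\in\mathcal{E}: x\equiv i \pmod k\}$. Here $a\bmod b$ is the remainder of Euclidean division. -}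

module Defs where

open import Data.Nat using (ℕ; zero; suc; _+_; _*_; _∸_; _≤_; _<_; NonZero)
open import Data.Nat.DivMod using (_/_; _%_)
open import Data.Product using (Σ; ∃; _×_; _,_)
open import Data.List using (List; length)
open import Data.List.Membership.Propositional using (_∈_)
open import Data.List.Relation.Unary.Unique.Propositional using (Unique)
open import Relation.Nullary using (¬_)
open import Relation.Binary.PropositionalEquality using (_≡_)
open import Function.Bundles using (_⇔_)

Representable : ℕ → ℕ → ℕ → Set
Representable s k x = ∃ λ a → ∃ λ b → x ≡ a * s + b * (s + k)

InP : ℕ → ℕ → ℕ → Set
InP s k x = (1 ≤ x) × ¬ Representable s k x

InE : ℕ → ℕ → ℕ → Set
InE s k x = InP s k x × (x ≤ s + k ∸ 1)

-- ledge 𝓛_i = {x ∈ ℰ : x ≡ i (mod k)}; for 0 ≤ i < k this means x mod k = i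
InLedge : (s k : ℕ) → .{{NonZero k}} → ℕ → ℕ → Set
InLedge s k i x = InE s k x × (x % k ≡ i)

HasCard : (ℕ → Set) → ℕ → Set
HasCard P n = Σ (List ℕ) λ xs → Unique xs × (∀ x → (x ∈ xs) ⇔ P x) × (length xs ≡ n)

-- ceiling division ⌈k / s⌉ (value 0 for s = 0, never used)
ceilDiv : ℕ → ℕ → ℕ
ceilDiv k zero = 0
ceilDiv k (suc s') = (k + s') / suc s'

module Submission where

-- For x < s + k a representation a s + b (s + k) must have b = 0, so ℰ consists of the
-- non-multiples of s in (0, s + k), and the ledge of i is the progression i, i + k, i + 2k, …
-- cut off below s + k = s̄ + (⌊s/k⌋ + 1) k, with its multiples of s removed. A multiple of s
-- below s + k is either below k, and then equal to its own residue, or it is ⌈k/s⌉ s, the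
-- unique multiple of s in [k, k + s), whose residue is at most s̄. So in each case the ledge
-- is an explicit arithmetic progression of difference k, whose length is read off the bounds.

open import Defs
open import Data.Nat using (ℕ; zero; suc; _+_; _*_; _∸_; _≤_; _<_; _>_; NonZero; >-nonZero; >-nonZero⁻¹; z≤n; s≤s; s≤s⁻¹; s<s⁻¹)
open import Data.Nat.Properties
open import Data.Nat.DivMod
open import Data.Nat.Divisibility using (_∣_; _∤_; divides; ∣-refl; ∣⇒≤; >⇒∤; m%n≡0⇒n∣m)
open import Data.Nat.Coprimality using (Coprime; coprime-divisor)
open import Data.Product using (_×_; _,_; ∃-syntax; uncurry)
open import Data.Sum using (_⊎_; inj₁; inj₂)
open import Data.Empty using (⊥-elim)
open import Data.List using (applyUpTo)
open import Data.List.Membership.Propositional using (_∈_)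
open import Data.List.Properties using (length-applyUpTo)
open import Data.List.Membership.Propositional.Properties using (∈-applyUpTo⁺; ∈-applyUpTo⁻)
open import Data.List.Relation.Unary.Unique.Propositional.Properties using (applyUpTo⁺₁)
open import Relation.Nullary using (¬_; yes; no)
open import Relation.Binary.PropositionalEquality
open import Function.Bundles using (_⇔_; mk⇔; Equivalence)
open import Function.Properties.Equivalence using () renaming (trans to ⇔-trans; sym to ⇔-sym)

HasCard-cong : ∀ {P R : ℕ → Set} {n} → (∀ x → P x ⇔ R x) → HasCard P n → HasCard R n
HasCard-cong P⇔R (xs , unique , xs⇔P , length≡n) = xs , unique , (λ x → ⇔-trans (xs⇔P x) (P⇔R x)) , length≡n

HasCard-progression : ∀ {P : ℕ → Set} a d n .{{_ : NonZero d}} →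
  (∀ {x} → P x → ∃[ t ] t < n × x ≡ a + t * d) →
  (∀ {t} → t < n → P (a + t * d)) →
  HasCard P n
HasCard-progression {P} a d n enumerates lies-in =
  applyUpTo term n , applyUpTo⁺₁ term n injective , (λ x → mk⇔ sound complete) , length-applyUpTo term n
  where
  term : ℕ → ℕ
  term t = a + t * d
  injective : ∀ {i j} → i < j → j < n → term i ≢ term j
  injective i<j _ = <⇒≢ (+-monoʳ-< a (*-monoˡ-< d i<j))
  sound : ∀ {x} → x ∈ applyUpTo term n → P x
  sound x∈ with t , t<n , refl ← ∈-applyUpTo⁻ term x∈ = lies-in t<n
  complete : ∀ {x} → P x → x ∈ applyUpTo term n
  complete Px with t , t<n , refl ← enumerates Px = ∈-applyUpTo⁺ term t<n

[r+q*n]%n≡r : ∀ {r n} q .{{_ : NonZero n}} → r < n → (r + q * n) % n ≡ r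
[r+q*n]%n≡r {r} {n} q r<n = trans ([m+kn]%n≡m%n r q n) (m<n⇒m%n≡m r<n)

[r+q*n]/n≡q : ∀ {r n} q .{{_ : NonZero n}} → r < n → (r + q * n) / n ≡ q
[r+q*n]/n≡q {r} {n} q r<n = begin
  (r + q * n) / n   ≡⟨ +-distrib-/-∣ʳ r (divides q refl) ⟩
  r / n + q * n / n ≡⟨ cong₂ _+_ (m<n⇒m/n≡0 r<n) (m*n/n≡m q n) ⟩
  q                 ∎
  where open ≡-Reasoning

m%n≡r⇒m≡r+[m/n]*n : ∀ {m n r} .{{_ : NonZero n}} → m % n ≡ r → m ≡ r + m / n * n
m%n≡r⇒m≡r+[m/n]*n {m} {n} refl = m≡m%n+[m/n]*n m n

a+t*k<b+u*k⇒t≤u : ∀ {a b t u k} → b < k → a + t * k < b + u * k → t ≤ u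
a+t*k<b+u*k⇒t≤u {a} {b} {t} {u} {k} b<k lt = ≮⇒≥ λ u<t → <-asym lt (begin-strict
  b + u * k <⟨ +-monoˡ-< (u * k) b<k ⟩
  suc u * k ≤⟨ *-monoˡ-≤ k u<t ⟩
  t * k     ≤⟨ m≤n+m (t * k) a ⟩
  a + t * k ∎)
  where open ≤-Reasoning

a+t*k<b+u*k⇒t<u : ∀ {a b t u k} → b ≤ a → a + t * k < b + u * k → t < u
a+t*k<b+u*k⇒t<u {k = k} b≤a lt = ≰⇒> λ u≤t → <⇒≱ lt (+-mono-≤ b≤a (*-monoˡ-≤ k u≤t))

t<u⇒a+t*k<b+u*k : ∀ {a b t u k} → a < k → t < u → a + t * k < b + u * k
t<u⇒a+t*k<b+u*k {a} {b} {t} {u} {k} a<k t<u = begin-strict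
  a + t * k <⟨ +-monoˡ-< (t * k) a<k ⟩
  suc t * k ≤⟨ *-monoˡ-≤ k t<u ⟩
  u * k     ≤⟨ m≤n+m (u * k) b ⟩
  b + u * k ∎
  where open ≤-Reasoning

m+n≤m*n : ∀ {m n} → 1 < m → 1 < n → m + n ≤ m * n
m+n≤m*n {m} {suc n} 1<m (s≤s 0<n) = begin
  m + suc n ≤⟨ +-monoʳ-≤ m (+-monoˡ-≤ n 0<n) ⟩
  m + (n + n) ≡⟨ cong (m +_) (sym (trans (*-comm n 2) (cong (n +_) (+-identityʳ n)))) ⟩
  m + n * 2 ≤⟨ +-monoʳ-≤ m (*-monoʳ-≤ n 1<m) ⟩
  m + n * m ≡⟨ cong (m +_) (*-comm n m) ⟩
  m + m * n ≡⟨ sym (*-suc m n) ⟩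
  m * suc n ∎
  where open ≤-Reasoning

ceilDiv-*-≥ : ∀ k s .{{_ : NonZero s}} → k ≤ ceilDiv k s * s
ceilDiv-*-≥ k s@(suc s') = +-cancelʳ-≤ s' k (ceilDiv k s * s) (begin
  k + s'                              ≡⟨ m≡m%n+[m/n]*n (k + s') s ⟩
  (k + s') % s + ceilDiv k s * s      ≤⟨ +-monoˡ-≤ (ceilDiv k s * s) (<⇒≤pred (m%n<n (k + s') s)) ⟩
  s' + ceilDiv k s * s                ≡⟨ +-comm s' _ ⟩
  ceilDiv k s * s + s'                ∎)
  where open ≤-Reasoning

ceilDiv-*-< : ∀ k s .{{_ : NonZero s}} → ceilDiv k s * s < k + s
ceilDiv-*-< k s@(suc s') = begin-strict
  ceilDiv k s * s ≤⟨ m/n*n≤m (k + s') s ⟩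
  k + s'          <⟨ +-monoʳ-< k (n<1+n s') ⟩
  k + s           ∎
  where open ≤-Reasoning

window-≤ : ∀ {k a b s} → k ≤ a * s → b * s < k + s → b ≤ a
window-≤ {k} {a} {b} {s} k≤as bs<k+s = ≮⇒≥ λ a<b → <⇒≱ (+-cancelʳ-< s (a * s) k (begin-strict
  a * s + s ≡⟨ +-comm (a * s) s ⟩
  suc a * s ≤⟨ *-monoˡ-≤ s a<b ⟩
  b * s     <⟨ bs<k+s ⟩
  k + s     ∎)) k≤as
  where open ≤-Reasoning

ceilDiv-unique : ∀ {k s j} .{{_ : NonZero s}} → k ≤ j * s → j * s < k + s → j ≡ ceilDiv k s
ceilDiv-unique {k} {s} k≤js js<k+s =
  ≤-antisym (window-≤ (ceilDiv-*-≥ k s) js<k+s) (window-≤ k≤js (ceilDiv-*-< k s))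

module _ {k s : ℕ} .{{_ : NonZero k}} .{{_ : NonZero s}} (s<k : s < k) where

  private
    k≤M*s : k ≤ ceilDiv k s * s
    k≤M*s = ceilDiv-*-≥ k s
    M*s∸k<s : ceilDiv k s * s ∸ k < s
    M*s∸k<s = m<n+o⇒m∸n<o _ k (ceilDiv-*-< k s)

    M*s%k≡M*s∸k : ceilDiv k s * s % k ≡ ceilDiv k s * s ∸ k
    M*s%k≡M*s∸k = begin
      ceilDiv k s * s % k                 ≡⟨ cong (_% k) (sym (m∸n+n≡m k≤M*s)) ⟩
      (ceilDiv k s * s ∸ k + k) % k       ≡⟨ cong (λ m → (ceilDiv k s * s ∸ k + m) % k) (sym (+-identityʳ k)) ⟩
      (ceilDiv k s * s ∸ k + 1 * k) % k   ≡⟨ [r+q*n]%n≡r 1 (<-trans M*s∸k<s s<k) ⟩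
      ceilDiv k s * s ∸ k                 ∎
      where open ≡-Reasoning

  ceilDiv-*≡%+k : ceilDiv k s * s ≡ ceilDiv k s * s % k + 1 * k
  ceilDiv-*≡%+k = begin
    ceilDiv k s * s               ≡⟨ sym (m∸n+n≡m k≤M*s) ⟩
    ceilDiv k s * s ∸ k + k       ≡⟨ cong₂ _+_ (sym M*s%k≡M*s∸k) (sym (+-identityʳ k)) ⟩
    ceilDiv k s * s % k + 1 * k   ∎
    where open ≡-Reasoning

  ceilDiv-*%<s : ceilDiv k s * s % k < s
  ceilDiv-*%<s = subst (_< s) (sym M*s%k≡M*s∸k) M*s∸k<s

ceilDiv-*%≤% : ∀ k s .{{_ : NonZero k}} .{{_ : NonZero s}} → ceilDiv k s * s % k ≤ s % k
ceilDiv-*%≤% k s with s <? k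
... | yes s<k = <⇒≤ (subst (ceilDiv k s * s % k <_) (sym (m<n⇒m%n≡m s<k)) (ceilDiv-*%<s s<k))
... | no s≮k = ≤-reflexive (begin
  ceilDiv k s * s % k ≡⟨ cong (λ j → j * s % k) (sym (ceilDiv-unique {j = 1} k≤1*s 1*s<k+s)) ⟩
  1 * s % k           ≡⟨ cong (_% k) (*-identityˡ s) ⟩
  s % k               ∎)
  where
  open ≡-Reasoning
  k≤1*s : k ≤ 1 * s
  k≤1*s = subst (k ≤_) (sym (*-identityˡ s)) (≮⇒≥ s≮k)
  1*s<k+s : 1 * s < k + s
  1*s<k+s = subst (_< k + s) (sym (*-identityˡ s)) (m<n+m s (>-nonZero⁻¹ k))

multiple-residue : ∀ {s k x} .{{_ : NonZero s}} .{{_ : NonZero k}} →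
  s ∣ x → x < s + k → s ∣ x % k ⊎ x % k ≡ ceilDiv k s * s % k
multiple-residue {s} {k} {x} s∣x@(divides j refl) x<s+k with x <? k
... | yes x<k = inj₁ (subst (s ∣_) (sym (m<n⇒m%n≡m x<k)) s∣x)
... | no x≮k = inj₂ (cong (λ i → i * s % k) (ceilDiv-unique {j = j} (≮⇒≥ x≮k) (subst (x <_) (+-comm s k) x<s+k)))

0<m<n⇒n∤m : ∀ {m n} → 0 < m → m < n → n ∤ m
0<m<n⇒n∤m 0<m m<n = >⇒∤ {{>-nonZero 0<m}} m<n

Gap : ℕ → ℕ → ℕ → Set
Gap s k x = 0 < x × x < s + k × s ∤ x

representable⇒∣ : ∀ {s k x} → x < s + k → Representable s k x → s ∣ x
representable⇒∣ _ (a , zero , refl) = divides a (+-identityʳ (a * _))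
representable⇒∣ {s} {k} x<s+k (a , suc b , refl) =
  ⊥-elim (<⇒≱ x<s+k (≤-trans (m≤m+n (s + k) (b * (s + k))) (m≤n+m _ (a * s))))

∣⇒representable : ∀ {s k x} → s ∣ x → Representable s k x
∣⇒representable (divides a x≡a*s) = a , 0 , trans x≡a*s (sym (+-identityʳ _))

InE⇔Gap : ∀ {s k x} .{{_ : NonZero s}} → InE s k x ⇔ Gap s k x
InE⇔Gap {suc _} = mk⇔
  (λ { ((0<x , x∉S) , x≤) → 0<x , s≤s x≤ , λ s∣x → x∉S (∣⇒representable s∣x) })
  (λ { (0<x , s≤s x≤ , s∤x) → (0<x , λ x∈S → s∤x (representable⇒∣ (s≤s x≤) x∈S)) , x≤ })

InLedge⇔ : ∀ {s k i x} .{{_ : NonZero s}} .{{_ : NonZero k}} → InLedge s k i x ⇔ (Gap s k x × x % k ≡ i)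
InLedge⇔ = mk⇔ (λ (e , r) → Equivalence.to InE⇔Gap e , r) (λ (g , r) → Equivalence.from InE⇔Gap g , r)

ledge-progression : ∀ {s k i} .{{_ : NonZero s}} .{{_ : NonZero k}} a n →
  (∀ {x} → Gap s k x → x % k ≡ i → ∃[ t ] t < n × x ≡ a + t * k) →
  (∀ {t} → t < n → Gap s k (a + t * k) × (a + t * k) % k ≡ i) →
  HasCard (InLedge s k i) n
ledge-progression {k = k} a n enumerates lies-in =
  HasCard-cong (λ _ → ⇔-sym InLedge⇔) (HasCard-progression a k n (uncurry enumerates) lies-in)

-- For k = 1 the residue s % k is 0, so this ledge starts at 1 instead of at s % k.
ledge-unit : ∀ {s} .{{_ : NonZero s}} → HasCard (InLedge s 1 0) ((s ∸ 1) / 1)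
ledge-unit {s@(suc s')} rewrite n/1≡n s' = ledge-progression 1 s' enumerates lies-in
  where
  enumerates : ∀ {x} → Gap s 1 x → x % 1 ≡ 0 → ∃[ t ] t < s' × x ≡ 1 + t * 1
  enumerates {suc x'} (_ , x<s+1 , s∤x) _ =
    x' , s<s⁻¹ (≤∧≢⇒< x≤s (λ x≡s → s∤x (subst (s ∣_) (sym x≡s) ∣-refl))) , cong suc (sym (*-identityʳ x'))
    where
    x≤s : suc x' ≤ s
    x≤s = s≤s⁻¹ (subst (suc x' <_) (+-comm s 1) x<s+1)
  lies-in : ∀ {t} → t < s' → Gap s 1 (1 + t * 1) × (1 + t * 1) % 1 ≡ 0
  lies-in {t} t<s' = (s≤s z≤n , <-≤-trans x<s (m≤m+n s 1) , 0<m<n⇒n∤m (s≤s z≤n) x<s) , n%1≡0 (1 + t * 1)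
    where
    x<s : 1 + t * 1 < s
    x<s = s≤s (subst (_< s') (sym (*-identityʳ t)) t<s')

module Ledges {s k : ℕ} .{{_ : NonZero s}} .{{_ : NonZero k}} (1<s : 1 < s) (1<k : 1 < k) (s⊥k : Coprime s k) where

  ρ Q : ℕ
  ρ = s % k
  Q = s / k

  ρ<k : ρ < k
  ρ<k = m%n<n s k

  s≡ρ+Q*k : s ≡ ρ + Q * k
  s≡ρ+Q*k = m≡m%n+[m/n]*n s k

  s+k≡ρ+[1+Q]*k : s + k ≡ ρ + suc Q * k
  s+k≡ρ+[1+Q]*k = begin
    s + k             ≡⟨ cong (_+ k) s≡ρ+Q*k ⟩
    ρ + Q * k + k     ≡⟨ +-assoc ρ (Q * k) k ⟩
    ρ + (Q * k + k)   ≡⟨ cong (ρ +_) (+-comm (Q * k) k) ⟩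
    ρ + suc Q * k     ∎
    where open ≡-Reasoning

  0<ρ : 0 < ρ
  0<ρ = n≢0⇒n>0 λ ρ≡0 → <⇒≢ 1<k (sym (s⊥k (m%n≡0⇒n∣m s k ρ≡0 , ∣-refl)))

  [s∸1]/k≡Q : (s ∸ 1) / k ≡ Q
  [s∸1]/k≡Q = begin
    (s ∸ 1) / k             ≡⟨ cong (λ m → (m ∸ 1) / k) s≡ρ+Q*k ⟩
    (ρ + Q * k ∸ 1) / k     ≡⟨ cong (_/ k) (+-∸-comm (Q * k) 0<ρ) ⟩
    (ρ ∸ 1 + Q * k) / k     ≡⟨ [r+q*n]/n≡q Q (≤-<-trans (m∸n≤m ρ 1) ρ<k) ⟩
    Q                       ∎
    where open ≡-Reasoning

  ledge-multiple : ∀ {i} → s ∣ i → 0 < i → HasCard (InLedge s k i) 0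
  ledge-multiple {i} s∣i 0<i = ledge-progression i 0 enumerates (λ ())
    where
    enumerates : ∀ {x} → Gap s k x → x % k ≡ i → ∃[ t ] t < 0 × x ≡ i + t * k
    enumerates {x} (_ , x<s+k , s∤x) x%k≡i with x / k | m%n≡r⇒m≡r+[m/n]*n x%k≡i
    ... | zero  | x≡i+0 = ⊥-elim (s∤x (subst (s ∣_) (sym (trans x≡i+0 (+-identityʳ i))) s∣i))
    ... | suc t | x≡i+[1+t]k = ⊥-elim (<⇒≱ x<s+k (begin
      s + k         ≤⟨ +-monoˡ-≤ k (∣⇒≤ {{>-nonZero 0<i}} s∣i) ⟩
      i + k         ≤⟨ +-monoʳ-≤ i (m≤m+n k (t * k)) ⟩
      i + suc t * k ≡⟨ sym x≡i+[1+t]k ⟩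
      x             ∎))
      where open ≤-Reasoning

  ledge-s%k : HasCard (InLedge s k ρ) ((s ∸ 1) / k)
  ledge-s%k rewrite [s∸1]/k≡Q = ledge-progression ρ Q enumerates lies-in
    where
    enumerates : ∀ {x} → Gap s k x → x % k ≡ ρ → ∃[ t ] t < Q × x ≡ ρ + t * k
    enumerates {x} (_ , x<s+k , s∤x) x%k≡ρ = x / k , ≤∧≢⇒< t≤Q t≢Q , x≡
      where
      x≡ : x ≡ ρ + x / k * k
      x≡ = m%n≡r⇒m≡r+[m/n]*n x%k≡ρ
      t≤Q : x / k ≤ Q
      t≤Q = s≤s⁻¹ (a+t*k<b+u*k⇒t<u ≤-refl (subst₂ _<_ x≡ s+k≡ρ+[1+Q]*k x<s+k))
      t≢Q : x / k ≢ Q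
      t≢Q t≡Q = s∤x (subst (s ∣_) (sym (trans x≡ (trans (cong (λ t → ρ + t * k) t≡Q) (sym s≡ρ+Q*k)))) ∣-refl)
    lies-in : ∀ {t} → t < Q → Gap s k (ρ + t * k) × (ρ + t * k) % k ≡ ρ
    lies-in {t} t<Q = (0<x , <-≤-trans x<s (m≤m+n s k) , 0<m<n⇒n∤m 0<x x<s) , [r+q*n]%n≡r t ρ<k
      where
      0<x : 0 < ρ + t * k
      0<x = ≤-trans 0<ρ (m≤m+n ρ (t * k))
      x<s : ρ + t * k < s
      x<s = subst (ρ + t * k <_) (sym s≡ρ+Q*k) (t<u⇒a+t*k<b+u*k ρ<k t<Q)

  ledge-ceilDiv : s < k → HasCard (InLedge s k (ceilDiv k s * s % k)) 1
  ledge-ceilDiv s<k = ledge-progression i 1 enumerates lies-in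
    where
    i : ℕ
    i = ceilDiv k s * s % k
    M*s≡i+k : ceilDiv k s * s ≡ i + 1 * k
    M*s≡i+k = ceilDiv-*≡%+k s<k
    i<s : i < s
    i<s = ceilDiv-*%<s s<k
    0<i : 0 < i
    0<i = n≢0⇒n>0 λ i≡0 → <⇒≢ 1<s (sym (s⊥k (∣-refl , divides (ceilDiv k s)
      (sym (trans M*s≡i+k (trans (cong (_+ 1 * k) i≡0) (+-identityʳ k)))))))
    enumerates : ∀ {x} → Gap s k x → x % k ≡ i → ∃[ t ] t < 1 × x ≡ i + t * k
    enumerates {x} (_ , x<s+k , s∤x) x%k≡i = x / k , ≤∧≢⇒< t≤1 t≢1 , x≡
      where
      x≡ : x ≡ i + x / k * k
      x≡ = m%n≡r⇒m≡r+[m/n]*n x%k≡i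
      t≤1 : x / k ≤ 1
      t≤1 = a+t*k<b+u*k⇒t≤u s<k (subst₂ _<_ x≡ (cong (s +_) (sym (+-identityʳ k))) x<s+k)
      t≢1 : x / k ≢ 1
      t≢1 t≡1 = s∤x (divides (ceilDiv k s) (trans x≡ (trans (cong (λ t → i + t * k) t≡1) (sym M*s≡i+k))))
    lies-in : ∀ {t} → t < 1 → Gap s k (i + t * k) × (i + t * k) % k ≡ i
    lies-in {zero} _ = subst (λ x → Gap s k x × x % k ≡ i) (sym (+-identityʳ i))
      ((0<i , <-≤-trans i<s (m≤m+n s k) , 0<m<n⇒n∤m 0<i i<s) , m<n⇒m%n≡m (<-trans i<s s<k))
    lies-in {suc _} (s≤s ())

  ledge-zero : HasCard (InLedge s k 0) ((s ∸ 1) / k + 1)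
  ledge-zero rewrite [s∸1]/k≡Q | +-comm Q 1 = ledge-progression k (suc Q) enumerates lies-in
    where
    enumerates : ∀ {x} → Gap s k x → x % k ≡ 0 → ∃[ t ] t < suc Q × x ≡ k + t * k
    enumerates {x} (0<x , x<s+k , _) x%k≡0 with x / k | m%n≡r⇒m≡r+[m/n]*n x%k≡0
    ... | zero  | x≡0 = ⊥-elim (<⇒≢ 0<x (sym x≡0))
    ... | suc t | x≡[1+t]k = t , a+t*k<b+u*k⇒t≤u {a = 0} ρ<k (subst₂ _<_ x≡[1+t]k s+k≡ρ+[1+Q]*k x<s+k) , x≡[1+t]k
    lies-in : ∀ {t} → t < suc Q → Gap s k (suc t * k) × suc t * k % k ≡ 0
    lies-in {t} t<1+Q = (≤-trans (>-nonZero⁻¹ k) (m≤m+n k (t * k)) , x<s+k , s∤x) , m*n%n≡0 (suc t) k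
      where
      x<s+k : suc t * k < s + k
      x<s+k = subst (suc t * k <_) (sym s+k≡ρ+[1+Q]*k) (+-mono-<-≤ 0<ρ (*-monoˡ-≤ k t<1+Q))
      s∤x : s ∤ suc t * k
      s∤x s∣x = <⇒≱ x<s+k (begin
        s + k     ≤⟨ m+n≤m*n 1<s 1<k ⟩
        s * k     ≤⟨ *-monoˡ-≤ k (∣⇒≤ (coprime-divisor s⊥k (subst (s ∣_) (*-comm (suc t) k) s∣x))) ⟩
        suc t * k ∎)
        where open ≤-Reasoning

  ledge-above : ∀ {i} → i < k → ρ < i → s ∤ i → HasCard (InLedge s k i) ((s ∸ 1) / k + 1)
  ledge-above {i} i<k ρ<i s∤i rewrite [s∸1]/k≡Q | +-comm Q 1 = ledge-progression i (suc Q) enumerates lies-in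
    where
    enumerates : ∀ {x} → Gap s k x → x % k ≡ i → ∃[ t ] t < suc Q × x ≡ i + t * k
    enumerates {x} (_ , x<s+k , _) x%k≡i =
      x / k , a+t*k<b+u*k⇒t<u (<⇒≤ ρ<i) (subst₂ _<_ x≡ s+k≡ρ+[1+Q]*k x<s+k) , x≡
      where
      x≡ : x ≡ i + x / k * k
      x≡ = m%n≡r⇒m≡r+[m/n]*n x%k≡i
    lies-in : ∀ {t} → t < suc Q → Gap s k (i + t * k) × (i + t * k) % k ≡ i
    lies-in {t} t<1+Q = (≤-trans (≤-trans 0<ρ (<⇒≤ ρ<i)) (m≤m+n i (t * k)) , x<s+k , s∤x) , x%k≡i
      where
      x<s+k : i + t * k < s + k
      x<s+k = subst (i + t * k <_) (sym s+k≡ρ+[1+Q]*k) (t<u⇒a+t*k<b+u*k {b = ρ} i<k t<1+Q)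
      x%k≡i : (i + t * k) % k ≡ i
      x%k≡i = [r+q*n]%n≡r t i<k
      s∤x : s ∤ i + t * k
      s∤x s∣x with multiple-residue s∣x x<s+k
      ... | inj₁ s∣x%k = s∤i (subst (s ∣_) x%k≡i s∣x%k)
      ... | inj₂ x%k≡M*s%k = <⇒≱ ρ<i (subst (_≤ ρ) (trans (sym x%k≡M*s%k) x%k≡i) (ceilDiv-*%≤% k s))

  ledge-below : ∀ {i} → 0 < i → i < ρ → i ≢ ceilDiv k s * s % k → HasCard (InLedge s k i) ((s ∸ 1) / k + 2)
  ledge-below {i} 0<i i<ρ i≢M*s%k rewrite [s∸1]/k≡Q | +-comm Q 2 = ledge-progression i (2 + Q) enumerates lies-in
    where
    i<k : i < k
    i<k = <-trans i<ρ ρ<k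
    enumerates : ∀ {x} → Gap s k x → x % k ≡ i → ∃[ t ] t < 2 + Q × x ≡ i + t * k
    enumerates {x} (_ , x<s+k , _) x%k≡i =
      x / k , s≤s (a+t*k<b+u*k⇒t≤u ρ<k (subst₂ _<_ x≡ s+k≡ρ+[1+Q]*k x<s+k)) , x≡
      where
      x≡ : x ≡ i + x / k * k
      x≡ = m%n≡r⇒m≡r+[m/n]*n x%k≡i
    lies-in : ∀ {t} → t < 2 + Q → Gap s k (i + t * k) × (i + t * k) % k ≡ i
    lies-in {t} (s≤s t≤1+Q) = (≤-trans 0<i (m≤m+n i (t * k)) , x<s+k , s∤x) , x%k≡i
      where
      x<s+k : i + t * k < s + k
      x<s+k = subst (i + t * k <_) (sym s+k≡ρ+[1+Q]*k) (+-mono-<-≤ i<ρ (*-monoˡ-≤ k t≤1+Q))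
      x%k≡i : (i + t * k) % k ≡ i
      x%k≡i = [r+q*n]%n≡r t i<k
      s∤x : s ∤ i + t * k
      s∤x s∣x with multiple-residue s∣x x<s+k
      ... | inj₁ s∣x%k = 0<m<n⇒n∤m 0<i (<-≤-trans i<ρ (m%n≤m s k)) (subst (s ∣_) x%k≡i s∣x%k)
      ... | inj₂ x%k≡M*s%k = i≢M*s%k (trans (sym x%k≡i) x%k≡M*s%k)

lemma3p12 : (s k : ℕ) → .{{_ : NonZero k}} → 2 ≤ s → Coprime s k →
    (i : ℕ) → i < k →
      ((s ∣ i) → i > 0 → HasCard (InLedge s k i) 0)
    × (i ≡ s % k → HasCard (InLedge s k i) ((s ∸ 1) / k))
    × (i ≡ (ceilDiv k s * s) % k → k > s → HasCard (InLedge s k i) 1)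
    × (i ≡ 0 → k > 1 → HasCard (InLedge s k i) ((s ∸ 1) / k + 1))
    × (s % k < i → ¬ (s ∣ i) → HasCard (InLedge s k i) ((s ∸ 1) / k + 1))
    × (0 < i → i < s % k → i ≢ (ceilDiv k s * s) % k → HasCard (InLedge s k i) ((s ∸ 1) / k + 2))
lemma3p12 s (suc zero) (s≤s (s≤s _)) _ zero _ =
  (λ _ ()) , (λ _ → ledge-unit) , (λ _ → λ { (s≤s ()) }) , (λ _ → λ { (s≤s ()) }) , (λ ()) , (λ ())
lemma3p12 s (suc zero) _ _ (suc _) (s≤s ())
lemma3p12 s k@(suc (suc _)) 2≤s@(s≤s (s≤s _)) s⊥k i i<k =
    (λ s∣i 0<i → ledge-multiple s∣i 0<i)
  , (λ { refl → ledge-s%k })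
  , (λ { refl s<k → ledge-ceilDiv s<k })
  , (λ { refl _ → ledge-zero })
  , (λ ρ<i s∤i → ledge-above i<k ρ<i s∤i)
  , (λ 0<i i<ρ i≢ → ledge-below 0<i i<ρ i≢)
  where open Ledges 2≤s (s≤s (s≤s z≤n)) s⊥k
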